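{- There is a constant $k_0$ such that for every integer $k\ge k_0$ and every tree $T$ with $6k$ vertices, there exist $13$ subtrees $T_1,\dots,T_{13}$ of $T$, each having at most $k$ vertices, such that $V(T_1)\cup\cdots\cup V(T_{13})=V(T)$.
   Context: Decomposing a tree into subtrees here allows vertices to be shared (replicated) among the subtrees; every vertex of $T$ must belong to at least one of the subtrees. -}

module Defs where

open import Data.Nat using (ℕ; zero; suc; _≤_)
open import Data.Fin using (Fin)
open import Data.Fin.Subset using (Subset; _∈_; ∣_∣)
open import Data.List using (List; []; _∷_; length)
open import Data.List.Relation.Unary.All using (All)
open import Data.List.Relation.Unary.Unique.Propositional using (Unique)
open import Data.Product using (Σ; ∃; _×_; _,_)
open import Relation.Binary.PropositionalEquality using (_≡_)
open import Relation.Nullary using (¬_)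
open import Data.Unit using (⊤)
open import Data.Maybe using (just)
import Data.List as List

record Graph (n : ℕ) : Set₁ where
  field
    Adj       : Fin n → Fin n → Set
    irrefl    : ∀ {x} → ¬ Adj x x
    sym       : ∀ {x y} → Adj x y → Adj y x
open Graph public

data WalkIn {n : ℕ} (G : Graph n) (P : Fin n → Set) : Fin n → Fin n → Set where
  [] : ∀ {x} → P x → WalkIn G P x x
  _∷_ : ∀ {x y z} → P x → Adj G x y × WalkIn G P y z → WalkIn G P x z

data Chain {n : ℕ} (G : Graph n) : List (Fin n) → Set where
  one  : ∀ x → Chain G (x ∷ [])
  step : ∀ {x y vs} → Adj G x y → Chain G (y ∷ vs) → Chain G (x ∷ y ∷ vs)

record Cycle {n : ℕ} (G : Graph n) : Set where
  field
    first  : Fin n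
    rest   : List (Fin n)
    last   : Fin n
    long   : 3 ≤ length (first ∷ rest)
    chain  : Chain G (first ∷ rest)
    distinct : Unique (first ∷ rest)
    lastIs : List.last (first ∷ rest) ≡ just last
    closing : Adj G last first

Connected : {n : ℕ} → Graph n → Set
Connected G = ∀ x y → WalkIn G (λ _ → ⊤) x y

IsTree : {n : ℕ} → Graph n → Set
IsTree G = Connected G × ¬ Cycle G

-- A subtree of a tree T, given by its vertex set S: S is nonempty and
-- the subgraph induced on S is connected (hence itself a tree).
IsSubtree : {n : ℕ} → Graph n → Subset n → Set
IsSubtree G S = ∃ (λ x → x ∈ S) × (∀ x y → x ∈ S → y ∈ S → WalkIn G (λ v → v ∈ S) x y)

-- A connected graph on n vertices has a walk through all its vertices with at most
-- 2n − 1 entries: starting from a single vertex, repeatedly pick an edge uw leaving the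
-- vertex set of the walk and splice the detour u → w → u into it, which adds two
-- entries and one new vertex. For n = 6k this walk has at most 12k entries. Cutting
-- it into consecutive blocks of k entries gives connected vertex sets of size at most k
-- covering T; empty blocks are replaced by a single vertex.
module Submission where

open import Defs
open import Data.Nat using (ℕ; zero; suc; _+_; _*_; _≤_; z≤n; s≤s)
open import Data.Nat.Properties
  using (≤-refl; ≤-trans; ≤-reflexive; n≤1+n; <-irrefl; m≤m+n; m⊓n≤m; m≤n+o⇒m∸n≤o;
         +-suc; +-monoʳ-≤; *-suc; *-assoc; *-monoʳ-≤; *-monoˡ-≤; module ≤-Reasoning)
open import Data.Fin as Fin using (Fin; toℕ)
open import Data.Fin.Properties using (all?; ¬∀⟶∃¬)
open import Data.Fin.Subset using (Subset; _∈_; _∉_; ∣_∣; _∪_; ⁅_⁆; ⊥; inside; outside)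
open import Data.Fin.Subset.Properties
  using (_∈?_; x∈p∪q⁺; x∈p∪q⁻; x∈⁅x⁆; x∈⁅y⁆⇒x≡y; ∉⊥; ∪-identityʳ;
         ∣⊥∣≡0; ∣⁅x⁆∣≡1; ∣p∣≤∣x∷p∣; ∣p∣≤n; p⊂q⇒∣p∣<∣q∣)
open import Data.Vec using ([]; _∷_)
open import Data.List using (List; []; _∷_; length; take; drop)
open import Data.List.Properties using (length-take; length-drop; take++drop≡id)
open import Data.List.Relation.Unary.Any using (here; there)
open import Data.List.Relation.Unary.Linked as Linked using (Linked; []; [-]; _∷_)
open import Data.List.Membership.Propositional using () renaming (_∈_ to _∈ₗ_)
open import Data.List.Membership.Propositional.Properties using (∈-++⁻)
open import Data.List.Relation.Binary.Subset.Propositional using () renaming (_⊆_ to _⊆ₗ_)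
open import Data.Product using (Σ; ∃; _×_; _,_)
open import Data.Sum using (inj₁; inj₂)
open import Data.Empty using (⊥-elim)
open import Relation.Binary.Core using (Rel)
open import Relation.Nullary using (yes; no)
open import Relation.Binary.PropositionalEquality as ≡ using (_≡_; refl; cong; subst)

module _ {A : Set} where

  take⁺ : ∀ {ℓ} {R : Rel A ℓ} k {xs} → Linked R xs → Linked R (take k xs)
  take⁺ zero          _        = []
  take⁺ (suc k)       []       = []
  take⁺ (suc zero)    (_ ∷ _)  = [-]
  take⁺ (suc zero)    [-]      = [-]
  take⁺ (suc (suc k)) [-]      = [-]
  take⁺ (suc (suc k)) (r ∷ rs) = r ∷ take⁺ (suc k) rs

  drop⁺ : ∀ {ℓ} {R : Rel A ℓ} k {xs} → Linked R xs → Linked R (drop k xs)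
  drop⁺ zero    {_}      rs = rs
  drop⁺ (suc k) {[]}     rs = rs
  drop⁺ (suc k) {x ∷ xs} rs = drop⁺ k (Linked.tail rs)

  detour : ∀ {u xs} → u ∈ₗ xs → A → List A
  detour {u} {_ ∷ xs} (here refl) w = u ∷ w ∷ u ∷ xs
  detour {_} {x ∷ _}  (there p)   w = x ∷ detour p w

  detour⁺ : ∀ {ℓ} {R : Rel A ℓ} {u w xs} → Linked R xs → (p : u ∈ₗ xs) → R u w → R w u →
            Linked R (detour p w)
  detour⁺ [-]      (here refl)         ruw rwu = ruw ∷ rwu ∷ [-]
  detour⁺ (r ∷ rs) (here refl)         ruw rwu = ruw ∷ rwu ∷ r ∷ rs
  detour⁺ (r ∷ rs) (there (here refl)) ruw rwu = r ∷ detour⁺ rs (here refl) ruw rwu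
  detour⁺ (r ∷ rs) (there (there p))   ruw rwu = r ∷ detour⁺ rs (there p) ruw rwu

  length-detour : ∀ {u w xs} (p : u ∈ₗ xs) → length (detour p w) ≡ 2 + length xs
  length-detour (here refl) = refl
  length-detour (there p)   = cong suc (length-detour p)

  ⊆-detour : ∀ {u w xs} (p : u ∈ₗ xs) → xs ⊆ₗ detour p w
  ⊆-detour (here refl) (here q)  = here q
  ⊆-detour (here refl) (there q) = there (there (there q))
  ⊆-detour (there p)   (here q)  = here q
  ⊆-detour (there p)   (there q) = there (⊆-detour p q)

  ∈-detour : ∀ {u w xs} (p : u ∈ₗ xs) → w ∈ₗ detour p w
  ∈-detour (here refl) = there (here refl)
  ∈-detour (there p)   = there (∈-detour p)

  module _ (k : ℕ) where

    block : ℕ → List A → List A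
    block zero    xs = take k xs
    block (suc i) xs = block i (drop k xs)

    length-block : ∀ i xs → length (block i xs) ≤ k
    length-block zero    xs = subst (_≤ k) (≡.sym (length-take k xs)) (m⊓n≤m k (length xs))
    length-block (suc i) xs = length-block i (drop k xs)

    block⁺ : ∀ {ℓ} {R : Rel A ℓ} i {xs} → Linked R xs → Linked R (block i xs)
    block⁺ zero    rs = take⁺ k rs
    block⁺ (suc i) rs = block⁺ i (drop⁺ k rs)

    ∈-block : ∀ m {x} xs → length xs ≤ m * k → x ∈ₗ xs → ∃ λ (i : Fin m) → x ∈ₗ block (toℕ i) xs
    ∈-block zero    []       _ ()
    ∈-block (suc m) {x} xs len x∈ with ∈-++⁻ (take k xs) (subst (x ∈ₗ_) (≡.sym (take++drop≡id k xs)) x∈)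
    ... | inj₁ x∈take = Fin.zero , x∈take
    ... | inj₂ x∈drop =
      let i , x∈block = ∈-block m (drop k xs) drop-short x∈drop in Fin.suc i , x∈block
      where
      drop-short : length (drop k xs) ≤ m * k
      drop-short = subst (_≤ m * k) (≡.sym (length-drop k xs)) (m≤n+o⇒m∸n≤o (length xs) k len)

  orSingleton : A → List A → List A
  orSingleton a []       = a ∷ []
  orSingleton _ (x ∷ xs) = x ∷ xs

  ⊆-orSingleton : ∀ a xs → xs ⊆ₗ orSingleton a xs
  ⊆-orSingleton a (x ∷ xs) x∈ = x∈

  ∃∈-orSingleton : ∀ a xs → ∃ (_∈ₗ orSingleton a xs)
  ∃∈-orSingleton a []       = a , here refl
  ∃∈-orSingleton _ (x ∷ xs) = x , here refl

  length-orSingleton : ∀ {k} a xs → 1 ≤ k → length xs ≤ k → length (orSingleton a xs) ≤ k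
  length-orSingleton a []       1≤k _   = 1≤k
  length-orSingleton a (x ∷ xs) _   len = len

  orSingleton⁺ : ∀ {ℓ} {R : Rel A ℓ} a {xs} → Linked R xs → Linked R (orSingleton a xs)
  orSingleton⁺ a []       = [-]
  orSingleton⁺ a [-]      = [-]
  orSingleton⁺ a (r ∷ rs) = r ∷ rs

∣p∪q∣≤∣p∣+∣q∣ : ∀ {n} (p q : Subset n) → ∣ p ∪ q ∣ ≤ ∣ p ∣ + ∣ q ∣
∣p∪q∣≤∣p∣+∣q∣ []            []            = z≤n
∣p∪q∣≤∣p∣+∣q∣ (inside ∷ p)  (b ∷ q)       =
  s≤s (≤-trans (∣p∪q∣≤∣p∣+∣q∣ p q) (+-monoʳ-≤ ∣ p ∣ (∣p∣≤∣x∷p∣ b q)))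
∣p∪q∣≤∣p∣+∣q∣ (outside ∷ p) (inside ∷ q)  =
  ≤-trans (s≤s (∣p∪q∣≤∣p∣+∣q∣ p q)) (≤-reflexive (≡.sym (+-suc ∣ p ∣ ∣ q ∣)))
∣p∪q∣≤∣p∣+∣q∣ (outside ∷ p) (outside ∷ q) = ∣p∪q∣≤∣p∣+∣q∣ p q

module _ {n : ℕ} where

  fromList : List (Fin n) → Subset n
  fromList []       = ⊥
  fromList (x ∷ xs) = ⁅ x ⁆ ∪ fromList xs

  ∈-fromList⁺ : ∀ {x xs} → x ∈ₗ xs → x ∈ fromList xs
  ∈-fromList⁺ {x} (here refl) = x∈p∪q⁺ (inj₁ (x∈⁅x⁆ x))
  ∈-fromList⁺ (there x∈)      = x∈p∪q⁺ (inj₂ (∈-fromList⁺ x∈))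

  ∈-fromList⁻ : ∀ {x} xs → x ∈ fromList xs → x ∈ₗ xs
  ∈-fromList⁻ []       x∈ = ⊥-elim (∉⊥ x∈)
  ∈-fromList⁻ (y ∷ xs) x∈ with x∈p∪q⁻ ⁅ y ⁆ (fromList xs) x∈
  ... | inj₁ x∈y  = here (x∈⁅y⁆⇒x≡y y x∈y)
  ... | inj₂ x∈xs = there (∈-fromList⁻ xs x∈xs)

  ∣fromList∣≤length : ∀ xs → ∣ fromList xs ∣ ≤ length xs
  ∣fromList∣≤length []       = ≤-reflexive (∣⊥∣≡0 n)
  ∣fromList∣≤length (x ∷ xs) = begin
    ∣ ⁅ x ⁆ ∪ fromList xs ∣         ≤⟨ ∣p∪q∣≤∣p∣+∣q∣ ⁅ x ⁆ (fromList xs) ⟩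
    ∣ ⁅ x ⁆ ∣ + ∣ fromList xs ∣     ≡⟨ cong (_+ ∣ fromList xs ∣) (∣⁅x⁆∣≡1 x) ⟩
    suc ∣ fromList xs ∣             ≤⟨ s≤s (∣fromList∣≤length xs) ⟩
    suc (length xs)                 ∎
    where open ≤-Reasoning

  ∣fromList∣-detour : ∀ {u w xs} (p : u ∈ₗ xs) → w ∉ fromList xs →
                      suc ∣ fromList xs ∣ ≤ ∣ fromList (detour p w) ∣
  ∣fromList∣-detour {w = w} {xs} p w∉ = p⊂q⇒∣p∣<∣q∣
    ( (λ x∈ → ∈-fromList⁺ (⊆-detour p (∈-fromList⁻ xs x∈)))
    , w , ∈-fromList⁺ (∈-detour p) , w∉ )

module _ {n : ℕ} (G : Graph n) where

  module _ {P : Fin n → Set} where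

    walk-++ : ∀ {x y z} → WalkIn G P x y → WalkIn G P y z → WalkIn G P x z
    walk-++ ([] _)           w′ = w′
    walk-++ (px ∷ (xy , w)) w′ = px ∷ (xy , walk-++ w w′)

    walk-snoc : ∀ {x y z} → WalkIn G P x y → Adj G y z → P z → WalkIn G P x z
    walk-snoc ([] px)         yz pz = px ∷ (yz , [] pz)
    walk-snoc (px ∷ (xy , w)) yz pz = px ∷ (xy , walk-snoc w yz pz)

    walk-reverse : ∀ {x y} → WalkIn G P x y → WalkIn G P y x
    walk-reverse ([] px)         = [] px
    walk-reverse (px ∷ (xy , w)) = walk-snoc (walk-reverse w) (Graph.sym G xy) px

  walk-map : ∀ {P Q : Fin n → Set} → (∀ {v} → P v → Q v) → ∀ {x y} → WalkIn G P x y → WalkIn G Q x y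
  walk-map f ([] px)         = [] (f px)
  walk-map f (px ∷ (xy , w)) = f px ∷ (xy , walk-map f w)

  linked⇒walk : ∀ {x xs y} → Linked (Adj G) (x ∷ xs) → y ∈ₗ x ∷ xs → WalkIn G (_∈ₗ x ∷ xs) x y
  linked⇒walk _        (here refl) = [] (here refl)
  linked⇒walk (r ∷ rs) (there y∈)  = here refl ∷ (r , walk-map there (linked⇒walk rs y∈))

  linked⇒subtree : ∀ {xs} → Linked (Adj G) xs → ∃ (_∈ₗ xs) → IsSubtree G (fromList xs)
  linked⇒subtree {x ∷ xs} rs (v , v∈) = (v , ∈-fromList⁺ v∈) , connected
    where
    connected : ∀ a b → a ∈ fromList (x ∷ xs) → b ∈ fromList (x ∷ xs) →
                WalkIn G (_∈ fromList (x ∷ xs)) a b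
    connected a b a∈ b∈ = walk-map ∈-fromList⁺
      (walk-++ (walk-reverse (linked⇒walk rs (∈-fromList⁻ _ a∈))) (linked⇒walk rs (∈-fromList⁻ _ b∈)))

  leavingEdge : ∀ {Q : Fin n → Set} (V : Subset n) {x y} → WalkIn G Q x y → x ∈ V → y ∉ V →
                ∃ λ u → ∃ λ v → u ∈ V × v ∉ V × Adj G u v
  leavingEdge V ([] _)      x∈ y∉ = ⊥-elim (y∉ x∈)
  leavingEdge V {x} (_∷_ {y = x′} _ (xx′ , w)) x∈ y∉ with x′ ∈? V
  ... | yes x′∈ = leavingEdge V w x′∈ y∉
  ... | no  x′∉ = x , x′ , x∈ , x′∉ , xx′

  record Tour (root : Fin n) : Set where
    field
      walk   : List (Fin n)
      linked : Linked (Adj G) walk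
      root∈  : root ∈ₗ walk
      short  : suc (length walk) ≤ 2 * ∣ fromList walk ∣
  open Tour

  module _ (connected : Connected G) {root : Fin n} where

    extendTour : (t : Tour root) → ∀ {w} → w ∉ fromList (walk t) →
                 Σ (Tour root) λ t′ → suc ∣ fromList (walk t) ∣ ≤ ∣ fromList (walk t′) ∣
    extendTour t {w} w∉ with leavingEdge (fromList (walk t)) (connected root w) (∈-fromList⁺ (root∈ t)) w∉
    ... | u , v , u∈ , v∉ , uv = t′ , grows
      where
      u∈ₗ : u ∈ₗ walk t
      u∈ₗ = ∈-fromList⁻ (walk t) u∈
      grows : suc ∣ fromList (walk t) ∣ ≤ ∣ fromList (detour u∈ₗ v) ∣
      grows = ∣fromList∣-detour u∈ₗ v∉
      t′ : Tour root
      t′ = record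
        { walk   = detour u∈ₗ v
        ; linked = detour⁺ (linked t) u∈ₗ uv (Graph.sym G uv)
        ; root∈  = ⊆-detour u∈ₗ (root∈ t)
        ; short  = begin
            suc (length (detour u∈ₗ v))     ≡⟨ cong suc (length-detour u∈ₗ) ⟩
            2 + suc (length (walk t))       ≤⟨ +-monoʳ-≤ 2 (short t) ⟩
            2 + 2 * ∣ fromList (walk t) ∣   ≡⟨ ≡.sym (*-suc 2 _) ⟩
            2 * suc ∣ fromList (walk t) ∣   ≤⟨ *-monoʳ-≤ 2 grows ⟩
            2 * ∣ fromList (detour u∈ₗ v) ∣ ∎
        }
        where open ≤-Reasoning

    spanningTour : ∀ fuel (t : Tour root) → n ≤ fuel + ∣ fromList (walk t) ∣ →
                   Σ (Tour root) λ t → ∀ v → v ∈ₗ walk t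
    spanningTour fuel t enough with all? (λ v → v ∈? fromList (walk t))
    ... | yes all∈ = t , λ v → ∈-fromList⁻ (walk t) (all∈ v)
    ... | no ¬all∈ with ¬∀⟶∃¬ n _ (λ v → v ∈? fromList (walk t)) ¬all∈
    ... | w , w∉ with extendTour t w∉ | fuel
    ... | t′ , grows | zero      =
      ⊥-elim (<-irrefl refl (≤-trans (s≤s enough) (≤-trans grows (∣p∣≤n (fromList (walk t′))))))
    ... | t′ , grows | suc fuel′ = spanningTour fuel′ t′
      (≤-trans enough (≤-trans (≤-reflexive (≡.sym (+-suc fuel′ ∣ fromList (walk t) ∣))) (+-monoʳ-≤ fuel′ grows)))

  spanningWalk : Connected G → Fin n →
                 ∃ λ xs → Linked (Adj G) xs × (∀ v → v ∈ₗ xs) × suc (length xs) ≤ 2 * n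
  spanningWalk connected root =
    let t , all∈ = spanningTour connected n start (m≤m+n n _)
    in walk t , linked t , all∈ , ≤-trans (short t) (*-monoʳ-≤ 2 (∣p∣≤n (fromList (walk t))))
    where
    start : Tour root
    start = record { walk = root ∷ [] ; linked = [-] ; root∈ = here refl ; short = short-singleton }
      where
      short-singleton : 2 ≤ 2 * ∣ ⁅ root ⁆ ∪ ⊥ ∣
      short-singleton rewrite ∪-identityʳ ⁅ root ⁆ | ∣⁅x⁆∣≡1 root = ≤-refl

lemma5 : Σ ℕ λ k₀ → (k : ℕ) → k₀ ≤ k → (T : Graph (6 * k)) → IsTree T →
    Σ (Fin 13 → Subset (6 * k)) λ S →
    ((i : Fin 13) → IsSubtree T (S i) × ∣ S i ∣ ≤ k) ×
    ((v : Fin (6 * k)) → ∃ λ i → v ∈ S i)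
-- k₀ = 1 because for k = 0 the 13 subtrees, being nonempty, cannot exist.
lemma5 = 1 , cover
  where
  cover : (k : ℕ) → 1 ≤ k → (T : Graph (6 * k)) → IsTree T →
    Σ (Fin 13 → Subset (6 * k)) λ S →
    ((i : Fin 13) → IsSubtree T (S i) × ∣ S i ∣ ≤ k) ×
    ((v : Fin (6 * k)) → ∃ λ i → v ∈ S i)
  cover k@(suc _) 1≤k T (connected , _) with spanningWalk T connected Fin.zero
  ... | xs , linked , all∈ , short = S , pieces , covered
    where
    piece : Fin 13 → List (Fin (6 * k))
    piece i = orSingleton Fin.zero (block k (toℕ i) xs)
    S : Fin 13 → Subset (6 * k)
    S i = fromList (piece i)

    pieces : (i : Fin 13) → IsSubtree T (S i) × ∣ S i ∣ ≤ k
    pieces i =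
      linked⇒subtree T (orSingleton⁺ Fin.zero (block⁺ k (toℕ i) linked)) (∃∈-orSingleton Fin.zero _) ,
      ≤-trans (∣fromList∣≤length (piece i))
              (length-orSingleton Fin.zero (block k (toℕ i) xs) 1≤k (length-block k (toℕ i) xs))

    fits : length xs ≤ 13 * k
    fits = begin
      length xs          ≤⟨ n≤1+n _ ⟩
      suc (length xs)    ≤⟨ short ⟩
      2 * (6 * k)        ≡⟨ ≡.sym (*-assoc 2 6 k) ⟩
      12 * k             ≤⟨ *-monoˡ-≤ k (n≤1+n 12) ⟩
      13 * k             ∎
      where open ≤-Reasoning

    covered : (v : Fin (6 * k)) → ∃ λ i → v ∈ S i
    covered v =
      let i , v∈ = ∈-block k 13 xs fits (all∈ v)
      in i , ∈-fromList⁺ (⊆-orSingleton Fin.zero _ v∈)
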